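{- Let $G$ be a connected graph of order $n\geq 5$ whose circumference $c(G)$ satisfies $4\leq c(G)\leq n$. Then $sdiam_3(G)\leq n-2$.
   Context: All graphs are finite, simple and undirected. The circumference $c(G)$ is the length of a longest cycle in $G$. For $S\subseteq V(G)$ with $|S|\geq 2$, the Steiner distance $d_G(S)$ is the minimum number of edges of a tree in $G$ whose vertex set contains $S$, and $sdiam_k(G)$ is the maximum of $d_G(S)$ over all $S\subseteq V(G)$ with $|S|=k$. -}

module Defs where

open import Data.Nat using (ℕ; suc; _≤_; _+_)
open import Data.Fin using (Fin)
open import Data.List using (List; []; _∷_; length; map; _++_)
open import Data.List.Membership.Propositional using (_∈_)
open import Data.List.Relation.Unary.Unique.Propositional using (Unique)
open import Data.List.Relation.Unary.All using (All)
open import Data.Product using (Σ; _×_; _,_; ∃)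
open import Data.Empty using (⊥)
open import Relation.Nullary using (¬_)
open import Relation.Binary.PropositionalEquality using (_≡_)

record Graph (n : ℕ) : Set₁ where
  field
    Adj      : Fin n → Fin n → Set
    sym      : ∀ {u v} → Adj u v → Adj v u
    irrefl   : ∀ {u} → ¬ Adj u u

open Graph public

data Walk {n : ℕ} (G : Graph n) : Fin n → Fin n → Set where
  here : ∀ {u} → Walk G u u
  step : ∀ {u w v} → Adj G u w → Walk G w v → Walk G u v

Connected : ∀ {n} → Graph n → Set
Connected G = ∀ u v → Walk G u v

data Chain {n : ℕ} (G : Graph n) : List (Fin n) → Set where
  single : ∀ {v} → Chain G (v ∷ [])
  cons   : ∀ {u v vs} → Adj G u v → Chain G (v ∷ vs) → Chain G (u ∷ v ∷ vs)

-- A cycle: list of k ≥ 3 distinct vertices v₁ … v_k with v_i v_{i+1} and v_k v₁ edges.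
record Cycle {n : ℕ} (G : Graph n) : Set where
  field
    first    : Fin n
    rest     : List (Fin n)
    last     : Fin n
    distinct : Unique (first ∷ rest Data.List.++ (last ∷ []))
    chain    : Chain G (first ∷ rest Data.List.++ (last ∷ []))
    closing  : Adj G last first
    long     : 1 ≤ length rest

cycleLength : ∀ {n} {G : Graph n} → Cycle G → ℕ
cycleLength C = 2 + length (Cycle.rest C)

IsCircumference : ∀ {n} → Graph n → ℕ → Set
IsCircumference G c =
  Σ (Cycle G) (λ C → cycleLength C ≡ c) × (∀ (C : Cycle G) → cycleLength C ≤ c)

-- Edges as ordered pairs (an undirected edge uv is represented once, either way).
Edge : ℕ → Set
Edge n = Fin n × Fin n

data EWalk {n : ℕ} (E : List (Edge n)) : Fin n → Fin n → Set where
  here : ∀ {u} → EWalk E u u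
  fwd  : ∀ {u w v} → (u , w) ∈ E → EWalk E w v → EWalk E u v
  bwd  : ∀ {u w v} → (w , u) ∈ E → EWalk E w v → EWalk E u v

record Tree {n : ℕ} (G : Graph n) : Set where
  field
    V        : List (Fin n)
    E        : List (Edge n)
    V-unique : Unique V
    E-unique : Unique (E ++ map (λ { (u , v) → (v , u) }) E)
    E-in-G   : All (λ { (u , v) → Adj G u v }) E
    E-in-V   : All (λ { (u , v) → (u ∈ V) × (v ∈ V) }) E
    conn     : ∀ {u v} → u ∈ V → v ∈ V → EWalk E u v
    size     : suc (length E) ≡ length V

treeSize : ∀ {n} {G : Graph n} → Tree G → ℕ
treeSize T = length (Tree.E T)

SteinerDistLe : ∀ {n} → Graph n → List (Fin n) → ℕ → Set
SteinerDistLe G S k = Σ (Tree G) (λ T → All (_∈ Tree.V T) S × treeSize T ≤ k)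

Sdiam3Le : ∀ {n} → Graph n → ℕ → Set
Sdiam3Le {n} G k = ∀ (x y z : Fin n) → Unique (x ∷ y ∷ z ∷ []) →
  SteinerDistLe G (x ∷ y ∷ z ∷ []) k

module Submission where

-- Let C be a longest cycle of G, so C has c ≥ 4 vertices.
-- Given three vertices x, y, z, follow a walk from each of them to C and stop
-- at the first vertex of C it reaches (its entry root).  As C has at least
-- four vertices, some vertex w of C is none of the three roots.  Deleting w
-- from C leaves a walk through all the other vertices of C, and the three
-- approach walks avoid w because they meet C only at their roots.  Growing a
-- tree first along that walk and then along the approach walks yields a tree
-- containing x, y and z but not w: it has at most n - 1 vertices, hence at
-- most n - 2 edges.

open import Defs hiding (sym)
open import Data.Nat using (ℕ; suc; _≤_; _<_; _∸_; s≤s; s≤s⁻¹; z≤n)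
open import Data.Nat.Properties using (≤⇒≯; ≤-trans)
open import Data.Fin using (Fin; _≟_)
open import Data.List using (List; []; _∷_; length; map; _++_)
open import Data.List.Properties using (++-assoc; length-tabulate; length-++-comm)
open import Data.List.Membership.Propositional using (_∈_; _∉_; find)
open import Data.List.Membership.Propositional.Properties
  using (∈-∃++; ∈-allFin; ∈-insert; ∈-++⁻; ∈-++⁺ˡ; ∈-++⁺ʳ)
open import Data.List.Relation.Binary.Subset.Propositional using (_⊆_)
open import Data.List.Relation.Binary.Subset.Propositional.Properties using (⊆-trans)
open import Data.List.Relation.Unary.Any using (here; there)
open import Data.List.Relation.Unary.All using (All; []; _∷_; all?)
import Data.List.Relation.Unary.All as All
import Data.List.Relation.Unary.All.Properties as All
open import Data.List.Relation.Unary.All.Properties using (¬Any⇒All¬; All¬⇒¬Any; ¬All⇒Any¬)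
open import Data.List.Relation.Unary.AllPairs using ([]; _∷_)
open import Data.List.Relation.Unary.Unique.Propositional using (Unique)
open import Data.Product using (Σ; ∃; ∃₂; _×_; _,_; proj₁; proj₂)
open import Data.Sum using (inj₁; inj₂)
open import Data.Empty using (⊥-elim)
open import Function using (_∘_)
open import Relation.Nullary using (yes; no; contradiction)
open import Relation.Binary.Definitions using (DecidableEquality)
open import Relation.Binary.PropositionalEquality
  using (_≡_; _≢_; refl; sym; trans; cong; subst)

module _ {A : Set} where

  All-insert : ∀ {P : A → Set} xs {ys z} → All P (xs ++ ys) → P z → All P (xs ++ z ∷ ys)
  All-insert xs ps pz = All.++⁺ (All.++⁻ˡ xs ps) (pz ∷ All.++⁻ʳ xs ps)

  Unique-insert : ∀ xs {ys} {z : A} → Unique (xs ++ ys) → z ∉ xs ++ ys → Unique (xs ++ z ∷ ys)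
  Unique-insert [] u z∉ = ¬Any⇒All¬ _ z∉ ∷ u
  Unique-insert (x ∷ xs) (x≢ ∷ u) z∉ =
    All-insert xs x≢ (λ x≡z → z∉ (here (sym x≡z))) ∷ Unique-insert xs u (z∉ ∘ there)

  Unique-split : ∀ xs {w : A} {ys} → Unique (xs ++ w ∷ ys) → w ∉ xs × w ∉ ys
  Unique-split [] (w≢ ∷ _) = (λ ()) , All¬⇒¬Any w≢
  Unique-split (x ∷ xs) {w} (x≢ ∷ u) with Unique-split xs u
  ... | w∉xs , w∉ys = w∉x∷xs , w∉ys
    where
    w∉x∷xs : w ∉ x ∷ xs
    w∉x∷xs (here w≡x) = All.lookup x≢ (∈-insert xs) (sym w≡x)
    w∉x∷xs (there w∈xs) = w∉xs w∈xs

  remove : ∀ {a : A} xs → a ∈ xs → List A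
  remove (_ ∷ xs) (here _) = xs
  remove (x ∷ xs) (there p) = x ∷ remove xs p

  length-remove : ∀ {a : A} xs (p : a ∈ xs) → suc (length (remove xs p)) ≡ length xs
  length-remove (_ ∷ xs) (here _) = refl
  length-remove (x ∷ xs) (there p) = cong suc (length-remove xs p)

  ∈-remove : ∀ {a b : A} xs (p : a ∈ xs) → b ∈ xs → a ≢ b → b ∈ remove xs p
  ∈-remove (_ ∷ xs) (here refl) (here refl) a≢b = ⊥-elim (a≢b refl)
  ∈-remove (_ ∷ xs) (here _) (there q) _ = q
  ∈-remove (_ ∷ xs) (there p) (here b≡x) _ = here b≡x
  ∈-remove (_ ∷ xs) (there p) (there q) a≢b = there (∈-remove xs p q a≢b)

  Unique-⊆⇒length≤ : ∀ {xs ys : List A} → Unique xs → xs ⊆ ys → length xs ≤ length ys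
  Unique-⊆⇒length≤ {[]} _ _ = z≤n
  Unique-⊆⇒length≤ {a ∷ xs} {ys} (a≢ ∷ u) a∷xs⊆ys =
    subst (suc (length xs) ≤_) (length-remove ys a∈ys) (s≤s (Unique-⊆⇒length≤ u xs⊆rest))
    where
    a∈ys : a ∈ ys
    a∈ys = a∷xs⊆ys (here refl)
    xs⊆rest : xs ⊆ remove ys a∈ys
    xs⊆rest b∈xs = ∈-remove ys a∈ys (a∷xs⊆ys (there b∈xs)) (All.lookup a≢ b∈xs)

module _ {A : Set} (_≟ᴬ_ : DecidableEquality A) where

  open import Data.List.Membership.DecPropositional _≟ᴬ_ using (_∈?_)

  missing : ∀ (xs ys : List A) → Unique xs → length ys < length xs → ∃ λ w → w ∈ xs × w ∉ ys
  missing xs ys u ys<xs with all? (_∈? ys) xs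
  ... | yes xs⊆ys = contradiction ys<xs (≤⇒≯ (Unique-⊆⇒length≤ u (All.lookup xs⊆ys)))
  ... | no xs⊈ys = find (¬All⇒Any¬ (_∈? ys) xs xs⊈ys)

length-omitting : ∀ {n} {w : Fin n} (vs : List (Fin n)) → Unique vs → w ∉ vs → suc (length vs) ≤ n
length-omitting {n} {w} vs u w∉vs =
  subst (suc (length vs) ≤_) (length-tabulate {n = n} (λ i → i))
    (Unique-⊆⇒length≤ (¬Any⇒All¬ vs w∉vs ∷ u) (λ {v} _ → ∈-allFin v))

module _ {n : ℕ} (G : Graph n) where

  open import Data.List.Membership.DecPropositional (_≟_ {n}) using (_∈?_)

  vertices : ∀ {s t} → Walk G s t → List (Fin n)
  vertices {s} here = s ∷ []
  vertices {s} (step _ wk) = s ∷ vertices wk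

  start∈ : ∀ {s t} (wk : Walk G s t) → s ∈ vertices wk
  start∈ here = here refl
  start∈ (step _ _) = here refl

  end∈ : ∀ {s t} (wk : Walk G s t) → t ∈ vertices wk
  end∈ here = here refl
  end∈ (step _ wk) = there (end∈ wk)

  chain⇒walk : ∀ {v vs} → Chain G (v ∷ vs) → ∃ λ t → Σ (Walk G v t) λ wk → vertices wk ≡ v ∷ vs
  chain⇒walk single = _ , here , refl
  chain⇒walk (cons a ch) with chain⇒walk ch
  ... | t , wk , vertices≡ = t , step a wk , cong (_ ∷_) vertices≡

  chain-join : ∀ xs {l f ys} → Chain G (xs ++ l ∷ []) → Adj G l f → Chain G (f ∷ ys) →
               Chain G (xs ++ l ∷ f ∷ ys)
  chain-join [] single a ch = cons a ch
  chain-join (x ∷ []) (cons b single) a ch = cons b (cons a ch)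
  chain-join (x ∷ y ∷ xs) (cons b ch′) a ch = cons b (chain-join (y ∷ xs) ch′ a ch)

  chain-suffix : ∀ xs {y ys} → Chain G (xs ++ y ∷ ys) → Chain G (y ∷ ys)
  chain-suffix [] ch = ch
  chain-suffix (x ∷ []) (cons _ ch) = ch
  chain-suffix (x ∷ x′ ∷ xs) (cons _ ch) = chain-suffix (x′ ∷ xs) ch

  chain-prefix : ∀ p ps {ys} → Chain G ((p ∷ ps) ++ ys) → Chain G (p ∷ ps)
  chain-prefix p [] _ = single
  chain-prefix p (q ∷ ps) (cons a ch) = cons a (chain-prefix q ps ch)

  record Entry (vs : List (Fin n)) (x : Fin n) : Set where
    field
      root     : Fin n
      root∈    : root ∈ vs
      path     : Walk G x root
      onlyRoot : All (λ v → v ∈ vs → v ≡ root) (vertices path)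

  firstEntry : ∀ vs {x t} → Walk G x t → t ∈ vs → Entry vs x
  firstEntry vs {x} wk t∈ with x ∈? vs
  ... | yes x∈ = record { root = x ; root∈ = x∈ ; path = here ; onlyRoot = (λ _ → refl) ∷ [] }
  firstEntry vs here t∈ | no x∉ = ⊥-elim (x∉ t∈)
  firstEntry vs (step a wk) t∈ | no x∉ = record
    { root = root ; root∈ = root∈ ; path = step a path ; onlyRoot = (⊥-elim ∘ x∉) ∷ onlyRoot }
    where open Entry (firstEntry vs wk t∈)

  entry-avoids : ∀ {vs x w} (e : Entry vs x) → w ∈ vs → w ≢ Entry.root e →
                 All (_≢ w) (vertices (Entry.path e))
  entry-avoids e w∈ w≢r = All.map (λ only v≡w → w≢r (trans (sym v≡w) (only (subst (_∈ _) (sym v≡w) w∈))))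
                                  (Entry.onlyRoot e)

  ewalk-weaken : ∀ {E : List (Edge n)} {e a b} → EWalk E a b → EWalk (e ∷ E) a b
  ewalk-weaken here = here
  ewalk-weaken (fwd p w) = fwd (there p) (ewalk-weaken w)
  ewalk-weaken (bwd p w) = bwd (there p) (ewalk-weaken w)

  ewalk-++ : ∀ {E : List (Edge n)} {a b c} → EWalk E a b → EWalk E b c → EWalk E a c
  ewalk-++ here w₂ = w₂
  ewalk-++ (fwd p w) w₂ = fwd p (ewalk-++ w w₂)
  ewalk-++ (bwd p w) w₂ = bwd p (ewalk-++ w w₂)

  singleton : Fin n → Tree G
  singleton r = record
    { V = r ∷ [] ; E = [] ; V-unique = [] ∷ [] ; E-unique = []
    ; E-in-G = [] ; E-in-V = []
    ; conn = λ { (here refl) (here refl) → here }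
    ; size = refl }

  Inside : List (Fin n) → Edge n → Set
  Inside vs e = (proj₁ e ∈ vs) × (proj₂ e ∈ vs)

  -- An edge to a new vertex is distinct from all present edges in either
  -- orientation.  The reversal map rev is abstracted since a tree stores it as
  -- an anonymous function.
  newEdge-unique : ∀ {vs} {rev : Edge n → Edge n} → (∀ a b → rev (a , b) ≡ (b , a)) →
    ∀ E {u v} → u ∈ vs → v ∉ vs → All (Inside vs) E →
    Unique (E ++ map rev E) → Unique ((u , v) ∷ E ++ (v , u) ∷ map rev E)
  newEdge-unique {vs} {rev} rev-flips E {u} {v} u∈ v∉ E-inside E-unique =
    All-insert E uv≢old uv≢vu ∷ Unique-insert E E-unique (v∉ ∘ proj₁ ∘ All.lookup old-inside)
    where
    flipped-inside : ∀ E′ → All (Inside vs) E′ → All (Inside vs) (map rev E′)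
    flipped-inside [] [] = []
    flipped-inside ((a , b) ∷ E′) ((a∈ , b∈) ∷ ins) =
      subst (Inside vs) (sym (rev-flips a b)) (b∈ , a∈) ∷ flipped-inside E′ ins
    old-inside : All (Inside vs) (E ++ map rev E)
    old-inside = All.++⁺ E-inside (flipped-inside E E-inside)
    uv≢old : All ((u , v) ≢_) (E ++ map rev E)
    uv≢old = All.map (λ { (_ , v∈) refl → v∉ v∈ }) old-inside
    uv≢vu : (u , v) ≢ (v , u)
    uv≢vu refl = v∉ u∈

  attach : (T : Tree G) {u v : Fin n} → u ∈ Tree.V T → v ∉ Tree.V T → Adj G u v → Tree G
  attach T {u} {v} u∈ v∉ uv = record
    { V = v ∷ V
    ; E = (u , v) ∷ E
    ; V-unique = ¬Any⇒All¬ V v∉ ∷ V-unique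
    ; E-unique = newEdge-unique (λ a b → refl) E u∈ v∉ E-inside E-unique
    ; E-in-G = uv ∷ E-in-G
    ; E-in-V = (there u∈ , here refl) ∷ All.map (λ { {_ , _} (a∈ , b∈) → there a∈ , there b∈ }) E-in-V
    ; conn = conn′
    ; size = cong suc size
    }
    where
    open Tree T
    E-inside : All (Inside V) E
    E-inside = All.map (λ { {_ , _} ins → ins }) E-in-V
    conn′ : ∀ {a b} → a ∈ v ∷ V → b ∈ v ∷ V → EWalk ((u , v) ∷ E) a b
    conn′ (here refl) (here refl) = here
    conn′ (here refl) (there b∈) = bwd (here refl) (ewalk-weaken (conn u∈ b∈))
    conn′ (there a∈) (here refl) = ewalk-++ (ewalk-weaken (conn a∈ u∈)) (fwd (here refl) here)
    conn′ (there a∈) (there b∈) = ewalk-weaken (conn a∈ b∈)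

  record Enlargement (Q : Fin n → Set) (T : Tree G) (vs : List (Fin n)) : Set where
    field
      tree    : Tree G
      holds   : All Q (Tree.V tree)
      keeps   : Tree.V T ⊆ Tree.V tree
      absorbs : vs ⊆ Tree.V tree

  grow : ∀ {Q : Fin n → Set} (T : Tree G) {s t} (wk : Walk G s t) → t ∈ Tree.V T →
         All Q (Tree.V T) → All Q (vertices wk) → Enlargement Q T (vertices wk)
  grow T here t∈ QT _ = record { tree = T ; holds = QT ; keeps = λ v∈ → v∈ ; absorbs = λ { (here refl) → t∈ } }
  grow T {s} (step a wk) t∈ QT (Qs ∷ Qwk) with grow T wk t∈ QT Qwk
  ... | T′ with s ∈? Tree.V (Enlargement.tree T′)
  ... | yes s∈ = record
    { tree = tree ; holds = holds ; keeps = keeps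
    ; absorbs = λ { (here refl) → s∈ ; (there v∈) → absorbs v∈ } }
    where open Enlargement T′
  ... | no s∉ = record
    { tree = attach tree (absorbs (start∈ wk)) s∉ (Graph.sym G a)
    ; holds = Qs ∷ holds
    ; keeps = there ∘ keeps
    ; absorbs = λ { (here refl) → here refl ; (there v∈) → there (absorbs v∈) }
    }
    where open Enlargement T′

  treeSize-omitting : (T : Tree G) {w : Fin n} → w ∉ Tree.V T → treeSize T ≤ n ∸ 2
  treeSize-omitting T w∉ =
    minus-two (subst (λ k → suc k ≤ n) (sym (Tree.size T)) (length-omitting (Tree.V T) (Tree.V-unique T) w∉))
    where
    minus-two : ∀ {m k} → suc (suc m) ≤ k → m ≤ k ∸ 2
    minus-two (s≤s (s≤s m≤k)) = m≤k

  -- vs is cyclic when traversing it twice in a row is a chain, i.e. consecutive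
  -- vertices and also its last and first vertex are adjacent.
  Cyclic : List (Fin n) → Set
  Cyclic vs = Chain G (vs ++ vs)

  cycleVertices : Cycle G → List (Fin n)
  cycleVertices C = Cycle.first C ∷ Cycle.rest C ++ Cycle.last C ∷ []

  length-cycleVertices : (C : Cycle G) → length (cycleVertices C) ≡ cycleLength C
  length-cycleVertices C = cong suc (length-++-comm (Cycle.rest C) (Cycle.last C ∷ []))

  -- The closing edge of a cycle joins its chain to a second copy of itself.
  cycle-cyclic : (C : Cycle G) → Cyclic (cycleVertices C)
  cycle-cyclic C = subst (Chain G) (cong (f ∷_) (sym (++-assoc r (l ∷ []) (cycleVertices C))))
    (chain-join (f ∷ r) (Cycle.chain C) (Cycle.closing C) (Cycle.chain C))
    where
    f l : Fin n
    f = Cycle.first C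
    l = Cycle.last C
    r : List (Fin n)
    r = Cycle.rest C

  record WalkAvoiding (vs : List (Fin n)) (w : Fin n) : Set where
    field
      start end : Fin n
      walk      : Walk G start end
      avoids    : All (_≢ w) (vertices walk)
      covers    : ∀ {v} → v ∈ vs → v ≢ w → v ∈ vertices walk

  rotate : ∀ xs {w} ys → Cyclic (xs ++ w ∷ ys) → Chain G (w ∷ (ys ++ xs) ++ w ∷ ys)
  rotate xs {w} ys cyc = chain-suffix xs (subst (Chain G) reassociate cyc)
    where
    reassociate : (xs ++ w ∷ ys) ++ (xs ++ w ∷ ys) ≡ xs ++ w ∷ (ys ++ xs) ++ w ∷ ys
    reassociate = trans (++-assoc xs (w ∷ ys) (xs ++ w ∷ ys))
                        (cong (λ L → xs ++ w ∷ L) (sym (++-assoc ys xs (w ∷ ys))))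

  walk-inside : ∀ {u} P {zs} → 1 ≤ length P → Chain G (u ∷ P ++ zs) →
                ∃₂ λ s t → Σ (Walk G s t) λ wk → vertices wk ≡ P
  walk-inside (p ∷ ps) _ (cons _ ch) = p , chain⇒walk (chain-prefix p ps ch)

  -- Deleting a vertex w from a cyclic duplicate-free list leaves a walk through
  -- all its other vertices: writing the list as xs ++ w ∷ ys, the walk runs along ys ++ xs.
  cyclic-minus : ∀ xs {w} ys → Unique (xs ++ w ∷ ys) → Cyclic (xs ++ w ∷ ys) →
                 2 ≤ length (xs ++ w ∷ ys) → WalkAvoiding (xs ++ w ∷ ys) w
  cyclic-minus xs {w} ys u cyc 2≤len
    with walk-inside (ys ++ xs) (s≤s⁻¹ (subst (2 ≤_) (length-++-comm xs (w ∷ ys)) 2≤len)) (rotate xs ys cyc)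
  ... | s , t , wk , vertices≡ = record
    { start = s ; end = t ; walk = wk
    ; avoids = subst (All (_≢ w)) (sym vertices≡) avoids
    ; covers = λ v∈ v≢w → subst (_ ∈_) (sym vertices≡) (covers v∈ v≢w)
    }
    where
    w∉xs : w ∉ xs
    w∉xs = proj₁ (Unique-split xs u)
    w∉ys : w ∉ ys
    w∉ys = proj₂ (Unique-split xs u)
    avoids : All (_≢ w) (ys ++ xs)
    avoids = All.map (λ w≢v v≡w → w≢v (sym v≡w)) (All.++⁺ (¬Any⇒All¬ ys w∉ys) (¬Any⇒All¬ xs w∉xs))
    covers : ∀ {v} → v ∈ xs ++ w ∷ ys → v ≢ w → v ∈ ys ++ xs
    covers v∈ v≢w with ∈-++⁻ xs v∈
    ... | inj₁ v∈xs = ∈-++⁺ʳ ys v∈xs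
    ... | inj₂ (here v≡w) = ⊥-elim (v≢w v≡w)
    ... | inj₂ (there v∈ys) = ∈-++⁺ˡ v∈ys

  cyclic-delete : ∀ vs {w} → Unique vs → Cyclic vs → 2 ≤ length vs → w ∈ vs → WalkAvoiding vs w
  cyclic-delete vs u cyc 2≤len w∈ with ∈-∃++ w∈
  ... | xs , ys , refl = cyclic-minus xs ys u cyc 2≤len

  spanning-tree : ∀ {vs w x y z} → WalkAvoiding vs w → w ∈ vs →
    (ex : Entry vs x) (ey : Entry vs y) (ez : Entry vs z) →
    w ≢ Entry.root ex → w ≢ Entry.root ey → w ≢ Entry.root ez →
    SteinerDistLe G (x ∷ y ∷ z ∷ []) (n ∸ 2)
  spanning-tree {vs} {w} {x} {y} {z} P w∈ ex ey ez w≢rx w≢ry w≢rz =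
    tree T₃ , (x∈ ∷ y∈ ∷ z∈ ∷ []) , treeSize-omitting (tree T₃) w∉T₃
    where
    open WalkAvoiding P
    open Enlargement
    -- Once a w-free tree contains the walk it contains every root, so an entry walk can be absorbed.
    absorb : ∀ {v} (e : Entry vs v) → w ≢ Entry.root e → (T : Tree G) → All (_≢ w) (Tree.V T) →
             vertices walk ⊆ Tree.V T → Enlargement (_≢ w) T (vertices (Entry.path e))
    absorb e w≢r T T-avoids walk⊆T =
      grow T (Entry.path e) (walk⊆T (covers (Entry.root∈ e) (w≢r ∘ sym))) T-avoids (entry-avoids e w∈ w≢r)
    T₀ : Enlargement (_≢ w) (singleton end) (vertices walk)
    T₀ = grow (singleton end) walk (here refl) (All.lookup avoids (end∈ walk) ∷ []) avoids
    T₁ : Enlargement (_≢ w) (tree T₀) (vertices (Entry.path ex))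
    T₁ = absorb ex w≢rx (tree T₀) (holds T₀) (absorbs T₀)
    T₂ : Enlargement (_≢ w) (tree T₁) (vertices (Entry.path ey))
    T₂ = absorb ey w≢ry (tree T₁) (holds T₁) (⊆-trans (absorbs T₀) (keeps T₁))
    T₃ : Enlargement (_≢ w) (tree T₂) (vertices (Entry.path ez))
    T₃ = absorb ez w≢rz (tree T₂) (holds T₂) (⊆-trans (⊆-trans (absorbs T₀) (keeps T₁)) (keeps T₂))
    x∈ : x ∈ Tree.V (tree T₃)
    x∈ = keeps T₃ (keeps T₂ (absorbs T₁ (start∈ (Entry.path ex))))
    y∈ : y ∈ Tree.V (tree T₃)
    y∈ = keeps T₃ (absorbs T₂ (start∈ (Entry.path ey)))
    z∈ : z ∈ Tree.V (tree T₃)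
    z∈ = absorbs T₃ (start∈ (Entry.path ez))
    w∉T₃ : w ∉ Tree.V (tree T₃)
    w∉T₃ w∈T₃ = All.lookup (holds T₃) w∈T₃ refl

  -- In a connected graph with a duplicate-free cyclic list of at least four
  -- vertices, any three vertices lie in a tree with at most n - 2 edges: some
  -- vertex of the list is none of the three entry roots, and it can be deleted.
  steiner-via-cyclic : ∀ vs → Unique vs → Cyclic vs → 4 ≤ length vs → Connected G →
                       ∀ x y z → SteinerDistLe G (x ∷ y ∷ z ∷ []) (n ∸ 2)
  steiner-via-cyclic (v₀ ∷ vs) u cyc 4≤len conn x y z = choose (enter x) (enter y) (enter z)
    where
    enter : ∀ v → Entry (v₀ ∷ vs) v
    enter v = firstEntry (v₀ ∷ vs) (conn v v₀) (here refl)
    choose : ∀ {x y z} → Entry (v₀ ∷ vs) x → Entry (v₀ ∷ vs) y → Entry (v₀ ∷ vs) z →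
             SteinerDistLe G (x ∷ y ∷ z ∷ []) (n ∸ 2)
    choose ex ey ez with missing _≟_ (v₀ ∷ vs) (Entry.root ex ∷ Entry.root ey ∷ Entry.root ez ∷ []) u 4≤len
    ... | w , w∈ , w∉roots =
      spanning-tree (cyclic-delete (v₀ ∷ vs) u cyc (≤-trans (s≤s (s≤s z≤n)) 4≤len) w∈) w∈ ex ey ez
        (w∉roots ∘ here) (w∉roots ∘ there ∘ here) (w∉roots ∘ there ∘ there ∘ here)

lemma3 : ∀ (n : ℕ) (G : Graph n) (c : ℕ) → 5 ≤ n → Connected G →
    IsCircumference G c → 4 ≤ c → c ≤ n → Sdiam3Le G (n ∸ 2)
lemma3 n G c _ conn ((C , |C|≡c) , _) 4≤c _ x y z _ =
  steiner-via-cyclic G (cycleVertices G C) (Cycle.distinct C) (cycle-cyclic G C) 4≤|C| conn x y z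
  where
  4≤|C| : 4 ≤ length (cycleVertices G C)
  4≤|C| = subst (4 ≤_) (sym (trans (length-cycleVertices G C) |C|≡c)) 4≤c
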